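{- Let $p>2$ be a prime, $k\ge2$, and let $\mathbf{L}$ be the Laplacian over $\mathbb{Z}_p$ of the star $G$ with vertex set $V=\{v_0,v_1,\ldots,v_k\}$ and edges $(v_0,v_i)$ of weight $w_i\ne0$ for $1\le i\le k$. Let $G'$ be the graph consisting of: the edges $(v_0,v_i)$ of weight $w_i$ for $3\le i\le k$; a new vertex $t$ with edges $(t,v_0)$ of weight $a$, $(t,v_1)$ of weight $b$, $(t,v_2)$ of weight $c$; and an edge $(v_1,v_2)$ of weight $d$. If $w_1+w_2\not\equiv0$, set $a=2(w_1+w_2)$, $b=2w_1$, $c=2w_2$, $d=-\frac{w_1w_2}{w_1+w_2}$; otherwise set $a=1$, $b=w_1$, $c=w_2$, $d=-w_1w_2$. Then the Laplacian $\hat{\mathbf{L}}$ of $G'$ satisfies $\mathrm{SC}(\hat{\mathbf{L}},V)=\mathbf{L}$.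
   Context: The Laplacian of a graph with edge weights in $\mathbb{Z}_p\setminus\{0\}$ is given by $\mathbf{L}_{a,a}=\sum_{(a,u)\in E}w_{a,u}$, $\mathbf{L}_{a,b}=-w_{a,b}$ for edges, $0$ otherwise. $\mathrm{SC}(\mathbf{A},T)=\mathbf{A}_{T,T}-\mathbf{A}_{T,S}\mathbf{A}_{S,S}^{ -1}\mathbf{A}_{S,T}$ with $S$ the complementary index set. -}

module Defs where

open import Data.Nat using (ℕ; zero; suc; _≤ᵇ_; _≡ᵇ_)
open import Data.Integer using (ℤ; +_; _+_; _-_; _*_; -_; 0ℤ; 1ℤ)
open import Data.Integer.Divisibility using (_∣_)
open import Data.Fin using (Fin; toℕ; inject₁; fromℕ) renaming (zero to fz; suc to fs)
import Data.Fin as F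
open import Data.Bool using (Bool; true; false; if_then_else_; _∧_)
open import Relation.Nullary using (does)

-- Congruence modulo p : the equality of ℤ_p (elements of ℤ_p represented by integers).
infix 4 _≡_[mod_] _≡ₘ_[mod_]

_≡_[mod_] : ℤ → ℤ → ℕ → Set
x ≡ y [mod p ] = (+ p) ∣ (x - y)

Mat : ℕ → Set
Mat n = Fin n → Fin n → ℤ

_≡ₘ_[mod_] : ∀ {n} → Mat n → Mat n → ℕ → Set
A ≡ₘ B [mod p ] = ∀ i j → A i j ≡ B i j [mod p ]

sumFin : ∀ {n} → (Fin n → ℤ) → ℤ
sumFin {zero}  f = 0ℤ
sumFin {suc n} f = f fz + sumFin (λ i → f (fs i))

-- Laplacian of a weighted graph given by a symmetric weight matrix W
-- (W a b = weight of edge (a,b), 0 if there is no edge; W a a = 0).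
-- L a a = Σ_u W a u ,  L a b = - W a b  (a ≠ b).
laplacian : ∀ {n} → Mat n → Mat n
laplacian W a b = if does (a F.≟ b) then sumFin (W a) else - (W a b)

-- Schur complement SC(A, T) where T = first n indices (inject₁) and the
-- eliminated set S = {last index} is a single vertex; A_{S,S}^{-1} is the
-- scalar `inv`, which is required (in the statement) to be an inverse of
-- A_{last,last} modulo p.
SC₁ : ∀ {n} → Mat (suc n) → ℤ → Mat n
SC₁ {n} A inv i j =
  A (inject₁ i) (inject₁ j) - (A (inject₁ i) (fromℕ n) * inv) * A (fromℕ n) (inject₁ j)

symW : ∀ {n} → (ℕ → ℕ → ℤ) → Mat n
symW e x y = e (toℕ x) (toℕ y) + e (toℕ y) (toℕ x)

-- Star G on vertices v₀..v_k (vertex vᵢ has label i): edges (v₀,vᵢ) of weight w i, 1 ≤ i ≤ k.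
starEdge : ℕ → (ℕ → ℤ) → ℕ → ℕ → ℤ
starEdge k w zero y    = if (1 ≤ᵇ y) ∧ (y ≤ᵇ k) then w y else 0ℤ
starEdge k w (suc _) _ = 0ℤ

starW : (k : ℕ) → (ℕ → ℤ) → Mat (suc k)
starW k w = symW (starEdge k w)

-- Graph G' on vertices v₀..v_k, t (t has label k+1):
-- (v₀,vᵢ) weight w i for 3 ≤ i ≤ k; (t,v₀) a; (t,v₁) b; (t,v₂) c; (v₁,v₂) d.
G'Edge : ℕ → (ℕ → ℤ) → ℤ → ℤ → ℤ → ℤ → ℕ → ℕ → ℤ
G'Edge k w a b c d x y =
  if y ≡ᵇ suc k then tEdge x else vEdge x
  where
  tEdge : ℕ → ℤ
  tEdge zero = a
  tEdge (suc zero) = b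
  tEdge (suc (suc zero)) = c
  tEdge _ = 0ℤ
  vEdge : ℕ → ℤ
  vEdge zero = if (3 ≤ᵇ y) ∧ (y ≤ᵇ k) then w y else 0ℤ
  vEdge (suc zero) = if y ≡ᵇ 2 then d else 0ℤ
  vEdge _ = 0ℤ

G'W : (k : ℕ) → (ℕ → ℤ) → ℤ → ℤ → ℤ → ℤ → Mat (suc (suc k))
G'W k w a b c d = symW (G'Edge k w a b c d)

{-# OPTIONS --safe #-}
module Submission where

-- Eliminating a vertex t from a Laplacian L′ gives again a Laplacian: the row sums stay zero,
-- and the weight between u ≠ v becomes w′(u,v) + w′(u,t) w′(t,v) / L′(t,t) (star–mesh
-- transform). A matrix with vanishing row sums is determined by its off-diagonal entries, so
-- only those need to be compared. In G′ the vertex t is adjacent to v₀, v₁, v₂ only, so the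
-- elimination adds ab/D, ac/D, bc/D to the edges of the triangle v₀v₁v₂ (D = a + b + c), and
-- a, b, c, d are chosen to make these w₁, w₂ and −d; all other edges of G′ are those of the star.

open import Defs
open import Data.Nat using (ℕ; suc; _≤_; _<_)
open import Data.Nat.Primality using (Prime)
open import Data.Integer using (ℤ; +_; _+_; _*_; -_; 0ℤ; 1ℤ)
open import Data.Fin using (fromℕ)
open import Data.Product using (_×_)
open import Relation.Nullary using (¬_)

open import Data.Bool using (true; false; if_then_else_)
open import Data.Bool.Properties using (if-eta)
open import Data.Empty using (⊥-elim)
open import Data.Fin using (Fin; toℕ; inject₁; punchIn) renaming (zero to fz; suc to fs)
import Data.Fin as Fin
open import Data.Fin.Properties
  using (toℕ-injective; toℕ<n; toℕ-fromℕ; toℕ-inject₁; fromℕ≢inject₁; inject₁-injective; punchInᵢ≢i)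
open import Data.Integer using (_-_)
open import Data.Integer.Divisibility using (_∣_)
import Data.Integer.Divisibility.Signed as Signed
open import Data.Integer.Properties using (+-*-semiring; +-inverseʳ; +-identityˡ; +-identityʳ; +-comm; *-zeroʳ; -1*i≡-i)
open import Algebra.Properties.Semiring.Sum +-*-semiring
  using (sum; sum-cong-≗; sum-init-last; sum-remove; sum-replicate-zero; *-distribˡ-sum)
open import Data.Integer.Tactic.RingSolver using (solve; solve-∀)
open import Data.List using (_∷_; [])
open import Data.Nat using (zero; z≤n; s≤s; _≡ᵇ_)
open import Data.Nat.Divisibility using (_∣0)
open import Data.Nat.Properties using (<-cmp; ≤-pred)
open import Data.Product using (_,_)
open import Data.Vec.Functional using (removeAt)
open import Function using (_∘_)
open import Level using (0ℓ)
open import Relation.Binary.Bundles using (Setoid)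
open import Relation.Binary.Definitions using (tri<; tri≈; tri>)
open import Relation.Binary.PropositionalEquality
  using (_≡_; _≢_; refl; sym; trans; cong; cong₂; subst; subst₂; module ≡-Reasoning)
open import Relation.Nullary using (yes; no)
open import Relation.Nullary.Decidable using (dec-true; dec-false)

sumFin≡sum : ∀ {n} (f : Fin n → ℤ) → sumFin f ≡ sum f
sumFin≡sum {zero}  f = refl
sumFin≡sum {suc n} f = cong (_+_ (f fz)) (sumFin≡sum (f ∘ fs))

sumFin-cong : ∀ {n} {f g : Fin n → ℤ} → (∀ i → f i ≡ g i) → sumFin f ≡ sumFin g
sumFin-cong {f = f} {g} f≗g = trans (sumFin≡sum f) (trans (sum-cong-≗ f≗g) (sym (sumFin≡sum g)))

sumFin-init-last : ∀ {n} (f : Fin (suc n) → ℤ) → sumFin f ≡ sumFin (f ∘ inject₁) + f (fromℕ n)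
sumFin-init-last f =
  trans (sumFin≡sum f) (trans (sum-init-last f) (cong (_+ f (fromℕ _)) (sym (sumFin≡sum (f ∘ inject₁)))))

sumFin-removeAt : ∀ {n} (f : Fin (suc n) → ℤ) i → sumFin f ≡ f i + sum (removeAt f i)
sumFin-removeAt f i = trans (sumFin≡sum f) (sum-remove f)

sum-neg : ∀ {n} (f : Fin n → ℤ) → sum (λ j → - f j) ≡ - sum f
sum-neg f = sym (trans (sym (-1*i≡-i (sum f))) (trans (*-distribˡ-sum (- 1ℤ) f) (sum-cong-≗ (-1*i≡-i ∘ f))))

sumFin-linear : ∀ {n} (f g : Fin n → ℤ) c → sumFin (λ j → f j - c * g j) ≡ sumFin f - c * sumFin g
sumFin-linear {zero}  f g c = solve (c ∷ [])
sumFin-linear {suc n} f g c =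
  trans (cong (_+_ (f fz - c * g fz)) (sumFin-linear (f ∘ fs) (g ∘ fs) c)) (regroup (f fz) (g fz) _ _ c)
  where
  regroup : ∀ x y S T c → (x - c * y) + (S - c * T) ≡ (x + S) - c * (y + T)
  regroup = solve-∀

laplacian-diag : ∀ {n} (W : Mat n) i → laplacian W i i ≡ sumFin (W i)
laplacian-diag W i = cong (λ b → if b then sumFin (W i) else - W i i) (dec-true (i Fin.≟ i) refl)

laplacian-offDiag : ∀ {n} (W : Mat n) {i j} → i ≢ j → laplacian W i j ≡ - W i j
laplacian-offDiag W {i} {j} i≢j = cong (λ b → if b then sumFin (W i) else - W i j) (dec-false (i Fin.≟ j) i≢j)

laplacian-rowSum : ∀ {n} (W : Mat n) i → sumFin (laplacian W i) ≡ W i i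
laplacian-rowSum {suc n} W i = begin
  sumFin (laplacian W i)                              ≡⟨ sumFin-removeAt (laplacian W i) i ⟩
  laplacian W i i + sum (removeAt (laplacian W i) i)  ≡⟨ cong₂ _+_ (laplacian-diag W i) (sum-cong-≗ offDiag) ⟩
  sumFin (W i) + sum (λ j → - removeAt (W i) i j)     ≡⟨ cong₂ _+_ (sumFin-removeAt (W i) i) (sum-neg (removeAt (W i) i)) ⟩
  (W i i + sum (removeAt (W i) i)) - sum (removeAt (W i) i) ≡⟨ cancel (W i i) _ ⟩
  W i i                                               ∎
  where
  open ≡-Reasoning
  offDiag : ∀ j → laplacian W i (punchIn i j) ≡ - W i (punchIn i j)
  offDiag j = laplacian-offDiag W (punchInᵢ≢i i j ∘ sym)
  cancel : ∀ x r → (x + r) - r ≡ x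
  cancel = solve-∀

SC₁-laplacian-offDiag : ∀ {n} (W : Mat (suc n)) inv {i j} → i ≢ j
  → SC₁ (laplacian W) inv i j
    ≡ - (W (inject₁ i) (inject₁ j) + W (inject₁ i) (fromℕ n) * inv * W (fromℕ n) (inject₁ j))
SC₁-laplacian-offDiag {n} W inv {i} {j} i≢j =
  trans (cong₂ _-_ (laplacian-offDiag W (i≢j ∘ inject₁-injective))
                   (cong₂ _*_ (cong (_* inv) (laplacian-offDiag W (fromℕ≢inject₁ ∘ sym)))
                              (laplacian-offDiag W fromℕ≢inject₁)))
        (regroup (W (inject₁ i) (inject₁ j)) (W (inject₁ i) (fromℕ n)) inv (W (fromℕ n) (inject₁ j)))
  where
  regroup : ∀ x y inv z → - x - ((- y) * inv) * (- z) ≡ - (x + y * inv * z)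
  regroup = solve-∀

module Congruence (p : ℕ) where

  -- A record, so that Agda can infer x and y from x ≈ y: x ≡ y [mod p] unfolds to a
  -- divisibility that depends on x and y only through ∣ x - y ∣.
  infix 4 _≈_
  record _≈_ (x y : ℤ) : Set where
    constructor mod
    field unmod : x ≡ y [mod p ]
  open _≈_ public

  ≈-reflexive : ∀ {x y} → x ≡ y → x ≈ y
  ≈-reflexive {x} refl = mod (subst ((+ p) ∣_) (sym (+-inverseʳ x)) (p ∣0))

  ≈-combination : ∀ {P Q x₁ y₁ x₂ y₂} α₁ α₂ → x₁ ≈ y₁ → x₂ ≈ y₂
                → P - Q ≡ α₁ * (x₁ - y₁) + α₂ * (x₂ - y₂) → P ≈ Q
  ≈-combination α₁ α₂ (mod h₁) (mod h₂) eq = mod (Signed.∣⇒∣ᵤ (subst (Signed._∣_ (+ p)) (sym eq)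
    (Signed.∣m∣n⇒∣m+n (Signed.∣n⇒∣m*n α₁ (Signed.∣ᵤ⇒∣ h₁)) (Signed.∣n⇒∣m*n α₂ (Signed.∣ᵤ⇒∣ h₂)))))

  ≈-multiple : ∀ {P Q x y} α → x ≈ y → P - Q ≡ α * (x - y) → P ≈ Q
  ≈-multiple {P} {Q} {x} {y} α h eq =
    ≈-combination α 0ℤ h h (trans eq (solve (α ∷ x ∷ y ∷ [])))

  ≈-sym : ∀ {x y} → x ≈ y → y ≈ x
  ≈-sym {x} {y} h = ≈-multiple (- 1ℤ) h (solve (x ∷ y ∷ []))

  ≈-trans : ∀ {x y z} → x ≈ y → y ≈ z → x ≈ z
  ≈-trans {x} {y} {z} h₁ h₂ = ≈-combination 1ℤ 1ℤ h₁ h₂ (solve (x ∷ y ∷ z ∷ []))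

  +-cong : ∀ {x x′ y y′} → x ≈ x′ → y ≈ y′ → x + y ≈ x′ + y′
  +-cong {x} {x′} {y} {y′} h₁ h₂ = ≈-combination 1ℤ 1ℤ h₁ h₂ (solve (x ∷ x′ ∷ y ∷ y′ ∷ []))

  -‿cong : ∀ {x y} → x ≈ y → - x ≈ - y
  -‿cong {x} {y} h = ≈-multiple (- 1ℤ) h (solve (x ∷ y ∷ []))

  ≈-setoid : Setoid 0ℓ 0ℓ
  ≈-setoid = record
    { Carrier = ℤ
    ; _≈_ = _≈_
    ; isEquivalence = record { refl = ≈-reflexive refl ; sym = ≈-sym ; trans = ≈-trans }
    }

  sum-cong-≈ : ∀ {n} {f g : Fin n → ℤ} → (∀ i → f i ≈ g i) → sum f ≈ sum g
  sum-cong-≈ {zero}  f≈g = ≈-reflexive refl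
  sum-cong-≈ {suc n} f≈g = +-cong (f≈g fz) (sum-cong-≈ (f≈g ∘ fs))

module LaplacianSchurComplement (p : ℕ) where
  open Congruence p

  RowSumsVanish : ∀ {n} → Mat n → Set
  RowSumsVanish A = ∀ i → sumFin (A i) ≈ 0ℤ

  laplacian-rowSumsVanish : ∀ {n} (W : Mat n) → (∀ i → W i i ≡ 0ℤ) → RowSumsVanish (laplacian W)
  laplacian-rowSumsVanish W W-diag i = ≈-reflexive (trans (laplacian-rowSum W i) (W-diag i))

  SC₁-rowSumsVanish : ∀ {n} (A : Mat (suc n)) inv → RowSumsVanish A
                    → inv * A (fromℕ n) (fromℕ n) ≈ 1ℤ → RowSumsVanish (SC₁ A inv)
  SC₁-rowSumsVanish {n} A inv rows inv-pivot i = begin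
    sumFin (SC₁ A inv i)                 ≡⟨ sumFin-linear (A (inject₁ i) ∘ inject₁) (A t ∘ inject₁) c ⟩
    initSum (inject₁ i) - c * initSum t  ≈⟨ ≈-combination 1ℤ (- c) (initSum≈ (inject₁ i)) (initSum≈ t)
                                              (eliminate (initSum (inject₁ i)) (initSum t) a (A t t) c) ⟩
    - a + c * A t t                      ≈⟨ ≈-multiple a inv-pivot (pivot a inv (A t t)) ⟩
    0ℤ                                   ∎
    where
    open import Relation.Binary.Reasoning.Setoid ≈-setoid
    t = fromℕ n
    a = A (inject₁ i) t
    c = a * inv
    initSum : Fin (suc n) → ℤ
    initSum x = sumFin (A x ∘ inject₁)
    initSum≈ : ∀ x → initSum x + A x t ≈ 0ℤ
    initSum≈ x = subst (_≈ 0ℤ) (sumFin-init-last (A x)) (rows x)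
    eliminate : ∀ S T a b c → (S - c * T) - (- a + c * b) ≡ 1ℤ * ((S + a) - 0ℤ) + (- c) * ((T + b) - 0ℤ)
    eliminate = solve-∀
    pivot : ∀ a inv b → (- a + (a * inv) * b) - 0ℤ ≡ a * (inv * b - 1ℤ)
    pivot = solve-∀

  ≈ₘ-fromOffDiag : ∀ {n} {A B : Mat n} → RowSumsVanish A → RowSumsVanish B
                 → (∀ {i j} → i ≢ j → A i j ≈ B i j) → ∀ i j → A i j ≈ B i j
  ≈ₘ-fromOffDiag {suc n} {A} {B} rowsA rowsB off i j with i Fin.≟ j
  ... | no i≢j = off i≢j
  ... | yes refl = ≈-combination 1ℤ (- 1ℤ) (≈-trans (splitRow {A} rowsA) (≈-sym (splitRow {B} rowsB)))
                     (sum-cong-≈ (λ k → off (punchInᵢ≢i i k ∘ sym)))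
                     (cancel (A i i) (B i i) (sum (removeAt (A i) i)) (sum (removeAt (B i) i)))
    where
    splitRow : ∀ {C : Mat (suc n)} → RowSumsVanish C → C i i + sum (removeAt (C i) i) ≈ 0ℤ
    splitRow {C} rows = subst (_≈ 0ℤ) (sumFin-removeAt (C i) i) (rows i)
    cancel : ∀ x y r s → x - y ≡ 1ℤ * ((x + r) - (y + s)) + (- 1ℤ) * (r - s)
    cancel = solve-∀

  SC₁-laplacian : ∀ {n} (W′ : Mat (suc n)) (W : Mat n) inv
    → (∀ i → W′ i i ≡ 0ℤ) → (∀ i → W i i ≡ 0ℤ)
    → inv * laplacian W′ (fromℕ n) (fromℕ n) ≈ 1ℤ
    → (∀ {i j} → i ≢ j
       → W′ (inject₁ i) (inject₁ j) + W′ (inject₁ i) (fromℕ n) * inv * W′ (fromℕ n) (inject₁ j) ≈ W i j)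
    → ∀ i j → SC₁ (laplacian W′) inv i j ≈ laplacian W i j
  SC₁-laplacian W′ W inv W′-diag W-diag inv-pivot mesh =
    ≈ₘ-fromOffDiag (SC₁-rowSumsVanish (laplacian W′) inv (laplacian-rowSumsVanish W′ W′-diag) inv-pivot)
                   (laplacian-rowSumsVanish W W-diag)
                   (λ i≢j → subst₂ _≈_ (sym (SC₁-laplacian-offDiag W′ inv i≢j)) (sym (laplacian-offDiag W i≢j))
                                     (-‿cong (mesh i≢j)))

≡ᵇ-refl : ∀ n → (n ≡ᵇ n) ≡ true
≡ᵇ-refl zero    = refl
≡ᵇ-refl (suc n) = ≡ᵇ-refl n

<⇒≡ᵇ-false : ∀ {m n} → m < n → (m ≡ᵇ n) ≡ false
<⇒≡ᵇ-false {zero}  {suc n} _           = refl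
<⇒≡ᵇ-false {suc m} {suc n} (s≤s m<n) = <⇒≡ᵇ-false m<n

starW-diag : ∀ k w (i : Fin (suc k)) → starW k w i i ≡ 0ℤ
starW-diag k w i with toℕ i
... | zero  = refl
... | suc _ = refl

tWeight : ℤ → ℤ → ℤ → ℕ → ℤ
tWeight a b c 0                   = a
tWeight a b c 1                   = b
tWeight a b c 2                   = c
tWeight a b c (suc (suc (suc _))) = 0ℤ

module StarMesh (p : ℕ) where
  open Congruence p

  record StarMeshConditions (w₁ w₂ a b c d inv : ℤ) : Set where
    field
      edge₀₁ : a * inv * b ≈ w₁
      edge₀₂ : a * inv * c ≈ w₂
      edge₁₂ : d + b * inv * c ≈ 0ℤ

  -- Both 4 inv and s invert w₁ + w₂, so b c inv = 4 w₁ w₂ inv ≈ w₁ w₂ s = − d.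
  starMesh-nonzeroSum : ∀ w₁ w₂ s inv → s * (w₁ + w₂) ≈ 1ℤ
    → inv * (+ 2 * (w₁ + w₂) + + 2 * w₁ + + 2 * w₂) ≈ 1ℤ
    → StarMeshConditions w₁ w₂ (+ 2 * (w₁ + w₂)) (+ 2 * w₁) (+ 2 * w₂) (- (w₁ * w₂ * s)) inv
  starMesh-nonzeroSum w₁ w₂ s inv s-inverse pivot-inverse = record
    { edge₀₁ = ≈-multiple w₁ pivot-inverse (solve (w₁ ∷ w₂ ∷ inv ∷ []))
    ; edge₀₂ = ≈-multiple w₂ pivot-inverse (solve (w₁ ∷ w₂ ∷ inv ∷ []))
    ; edge₁₂ = ≈-combination (w₁ * w₂ * s) (- (+ 4 * w₁ * w₂ * inv)) pivot-inverse s-inverse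
                 (solve (w₁ ∷ w₂ ∷ s ∷ inv ∷ []))
    }

  -- Here D = 1 + w₁ + w₂ ≈ 1, so inv ≈ 1.
  starMesh-zeroSum : ∀ w₁ w₂ inv → w₁ + w₂ ≈ 0ℤ → inv * (1ℤ + w₁ + w₂) ≈ 1ℤ
    → StarMeshConditions w₁ w₂ 1ℤ w₁ w₂ (- (w₁ * w₂)) inv
  starMesh-zeroSum w₁ w₂ inv zero-sum pivot-inverse = record
    { edge₀₁ = ≈-combination w₁ (- (w₁ * inv)) pivot-inverse zero-sum (solve (w₁ ∷ w₂ ∷ inv ∷ []))
    ; edge₀₂ = ≈-combination w₂ (- (w₂ * inv)) pivot-inverse zero-sum (solve (w₁ ∷ w₂ ∷ inv ∷ []))
    ; edge₁₂ = ≈-combination (w₁ * w₂) (- (w₁ * w₂ * inv)) pivot-inverse zero-sum (solve (w₁ ∷ w₂ ∷ inv ∷ []))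
    }

module TriangleGadget (p : ℕ) (m : ℕ) (w : ℕ → ℤ) (a b c d inv : ℤ) where
  open Congruence p
  open LaplacianSchurComplement p
  open StarMesh p

  k : ℕ
  k = suc (suc m)

  e : ℕ → ℕ → ℤ
  e = G'Edge k w a b c d

  t : Fin (suc (suc k))
  t = fromℕ (suc k)

  G'Edge-tWeight : ∀ x → e (suc k) x + e x (suc k) ≡ tWeight a b c x
  G'Edge-tWeight 0 rewrite ≡ᵇ-refl m = +-identityˡ a
  G'Edge-tWeight 1 rewrite ≡ᵇ-refl m = +-identityˡ b
  G'Edge-tWeight 2 rewrite ≡ᵇ-refl m = +-identityˡ c
  G'Edge-tWeight (suc (suc (suc z))) rewrite ≡ᵇ-refl m | if-eta (z ≡ᵇ m) {0ℤ} = refl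

  G'W-diag : ∀ i → G'W k w a b c d i i ≡ 0ℤ
  G'W-diag i with toℕ i
  ... | 0 = refl
  ... | 1 = refl
  ... | 2 = refl
  ... | suc (suc (suc z)) rewrite if-eta (z ≡ᵇ m) {0ℤ} = refl

  G'W-pivotRow : ∀ j → G'W k w a b c d t j ≡ tWeight a b c (toℕ j)
  G'W-pivotRow j = trans (cong (λ x → e x (toℕ j) + e (toℕ j) x) (toℕ-fromℕ (suc k))) (G'Edge-tWeight (toℕ j))

  G'W-pivotColumn : ∀ i → G'W k w a b c d (inject₁ i) t ≡ tWeight a b c (toℕ i)
  G'W-pivotColumn i = trans (+-comm (e (toℕ (inject₁ i)) (toℕ t)) (e (toℕ t) (toℕ (inject₁ i))))
                            (trans (G'W-pivotRow (inject₁ i)) (cong (tWeight a b c) (toℕ-inject₁ i)))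

  G'-pivot : laplacian (G'W k w a b c d) t t ≡ a + b + c
  G'-pivot = begin
    laplacian (G'W k w a b c d) t t              ≡⟨ laplacian-diag (G'W k w a b c d) t ⟩
    sumFin (G'W k w a b c d t)                   ≡⟨ sumFin-cong G'W-pivotRow ⟩
    a + (b + (c + sumFin {suc m} (λ _ → 0ℤ)))    ≡⟨ cong (λ z → a + (b + (c + z))) zeros ⟩
    a + (b + (c + 0ℤ))                           ≡⟨ solve (a ∷ b ∷ c ∷ []) ⟩
    a + b + c                                    ∎
    where
    open ≡-Reasoning
    zeros : sumFin {suc m} (λ _ → 0ℤ) ≡ 0ℤ
    zeros = trans (sumFin≡sum {suc m} (λ _ → 0ℤ)) (sum-replicate-zero (suc m))

  module _ (conditions : StarMeshConditions (w 1) (w 2) a b c d inv) where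
    open StarMeshConditions conditions

    star : ℕ → ℕ → ℤ
    star = starEdge k w

    starMesh-< : ∀ {x y} → x < y → y ≤ k
               → e x y + e y x + tWeight a b c x * inv * tWeight a b c y ≈ star x y + star y x
    starMesh-< {0} {1} _ _ = subst₂ _≈_ (sym (+-identityˡ _)) (sym (+-identityʳ (w 1))) edge₀₁
    starMesh-< {0} {2} _ _ = subst₂ _≈_ (sym (+-identityˡ _)) (sym (+-identityʳ (w 2))) edge₀₂
    starMesh-< {1} {2} _ _ = subst (_≈ 0ℤ) (cong (_+ b * inv * c) (sym (+-identityʳ d))) edge₁₂
    starMesh-< {0} {suc (suc (suc z))} _ (s≤s (s≤s z<m))
      rewrite <⇒≡ᵇ-false z<m | *-zeroʳ (a * inv) = ≈-reflexive (+-identityʳ _)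
    starMesh-< {1} {suc (suc (suc z))} _ (s≤s (s≤s z<m))
      rewrite <⇒≡ᵇ-false z<m | *-zeroʳ (b * inv) = ≈-reflexive refl
    starMesh-< {2} {suc (suc (suc z))} _ (s≤s (s≤s z<m))
      rewrite <⇒≡ᵇ-false z<m | *-zeroʳ (c * inv) = ≈-reflexive refl
    starMesh-< {suc (suc (suc z))} {suc (suc (suc z′))} _ _
      rewrite if-eta (z ≡ᵇ m) {0ℤ} | if-eta (z′ ≡ᵇ m) {0ℤ} = ≈-reflexive refl
    starMesh-< {1} {1} (s≤s ()) _
    starMesh-< {2} {1} (s≤s ()) _
    starMesh-< {2} {2} (s≤s (s≤s ())) _
    starMesh-< {suc (suc (suc _))} {1} (s≤s ()) _
    starMesh-< {suc (suc (suc _))} {2} (s≤s (s≤s ())) _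

    starMesh : ∀ {x y} → x ≢ y → x ≤ k → y ≤ k
             → e x y + e y x + tWeight a b c x * inv * tWeight a b c y ≈ star x y + star y x
    starMesh {x} {y} x≢y x≤k y≤k with <-cmp x y
    ... | tri< x<y _ _ = starMesh-< x<y y≤k
    ... | tri≈ _ x≡y _ = ⊥-elim (x≢y x≡y)
    ... | tri> _ _ y<x = subst₂ _≈_ swap (+-comm (star y x) (star x y)) (starMesh-< y<x x≤k)
      where
      commute : ∀ u v z → u * v * z ≡ z * v * u
      commute = solve-∀
      swap : e y x + e x y + tWeight a b c y * inv * tWeight a b c x
           ≡ e x y + e y x + tWeight a b c x * inv * tWeight a b c y
      swap = cong₂ _+_ (+-comm (e y x) (e x y)) (commute (tWeight a b c y) inv (tWeight a b c x))

    G'-starMesh : ∀ {i j} → i ≢ j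
                → G'W k w a b c d (inject₁ i) (inject₁ j) + G'W k w a b c d (inject₁ i) t * inv * G'W k w a b c d t (inject₁ j)
                  ≈ starW k w i j
    G'-starMesh {i} {j} i≢j =
      subst (_≈ starW k w i j) (sym relabel) (starMesh (i≢j ∘ toℕ-injective) (≤-pred (toℕ<n i)) (≤-pred (toℕ<n j)))
      where
      relabel : G'W k w a b c d (inject₁ i) (inject₁ j) + G'W k w a b c d (inject₁ i) t * inv * G'W k w a b c d t (inject₁ j)
              ≡ e (toℕ i) (toℕ j) + e (toℕ j) (toℕ i) + tWeight a b c (toℕ i) * inv * tWeight a b c (toℕ j)
      relabel = cong₂ _+_ (cong₂ (λ x y → e x y + e y x) (toℕ-inject₁ i) (toℕ-inject₁ j))
                          (cong₂ (λ u v → u * inv * v) (G'W-pivotColumn i)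
                                 (trans (G'W-pivotRow (inject₁ j)) (cong (tWeight a b c) (toℕ-inject₁ j))))

  G'-reducesToStar : (inv * (a + b + c) ≈ 1ℤ → StarMeshConditions (w 1) (w 2) a b c d inv)
                   → inv * laplacian (G'W k w a b c d) t t ≡ 1ℤ [mod p ]
                   → SC₁ (laplacian (G'W k w a b c d)) inv ≡ₘ laplacian (starW k w) [mod p ]
  G'-reducesToStar conditions pivot-inverse i j =
    unmod (SC₁-laplacian (G'W k w a b c d) (starW k w) inv G'W-diag (starW-diag k w) (mod pivot-inverse)
                         (G'-starMesh (conditions (subst (λ z → inv * z ≈ 1ℤ) G'-pivot (mod pivot-inverse)))) i j)

lemma6p3 : (p : ℕ) → Prime p → 2 < p → (k : ℕ) → 2 ≤ k → (w : ℕ → ℤ)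
    → (∀ i → 1 ≤ i → i ≤ k → ¬ (w i ≡ 0ℤ [mod p ]))
    → ((¬ (w 1 + w 2 ≡ 0ℤ [mod p ]))
        → (s : ℤ) → s * (w 1 + w 2) ≡ 1ℤ [mod p ]
        → (inv : ℤ)
        → inv * laplacian (G'W k w (+ 2 * (w 1 + w 2)) (+ 2 * w 1) (+ 2 * w 2) (- (w 1 * w 2 * s))) (fromℕ (suc k)) (fromℕ (suc k)) ≡ 1ℤ [mod p ]
        → SC₁ (laplacian (G'W k w (+ 2 * (w 1 + w 2)) (+ 2 * w 1) (+ 2 * w 2) (- (w 1 * w 2 * s)))) inv ≡ₘ laplacian (starW k w) [mod p ])
      × ((w 1 + w 2 ≡ 0ℤ [mod p ])
        → (inv : ℤ)
        → inv * laplacian (G'W k w 1ℤ (w 1) (w 2) (- (w 1 * w 2))) (fromℕ (suc k)) (fromℕ (suc k)) ≡ 1ℤ [mod p ]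
        → SC₁ (laplacian (G'W k w 1ℤ (w 1) (w 2) (- (w 1 * w 2)))) inv ≡ₘ laplacian (starW k w) [mod p ])
-- Primality of p, p > 2 and the non-vanishing of the weights only serve to make the inverses
-- s and inv exist; here they are given.
lemma6p3 p _ _ (suc (suc m)) (s≤s (s≤s z≤n)) w _ =
    (λ _ s s-inverse inv →
       TriangleGadget.G'-reducesToStar p m w _ _ _ _ inv (starMesh-nonzeroSum (w 1) (w 2) s inv (mod s-inverse)))
  , (λ zero-sum inv →
       TriangleGadget.G'-reducesToStar p m w _ _ _ _ inv (starMesh-zeroSum (w 1) (w 2) inv (mod zero-sum)))
  where
  open Congruence p
  open StarMesh p
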